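{- Let $F:\mathbf{Set}\to\mathbf{Set}$ be a covariant endofunctor and let $\bar F:\mathbf{Set}\times\mathbf{Set}\to\mathbf{Set}\times\mathbf{Set}$ be its extension, $\bar F(V,E)=(1,FV)$ and $\bar F(\phi_V,\phi_E)=(!,F(\phi_V))$. Then: (i) for every small category $I$, if $F$ preserves limits of all $I$-shaped diagrams in $\mathbf{Set}$, then $\bar F$ preserves limits of all $I$-shaped diagrams in $\mathbf{Set}\times\mathbf{Set}$ (i.e. $\bar F$ preserves all limits that $F$ preserves); (ii) $\bar F$ is bounded if and only if $F$ is bounded.
   Context: Here $1$ denotes a terminal (one-element) set and $!:V\to 1$ the unique map. A functor $F$ on $\mathbf{Set}$ is bounded if there is a cardinal $\kappa$ such that for every set $X$ and every $x\in FX$ there is a subset $Y\subseteq X$ with $|Y|<\kappa$ and $x$ in the image of $F(i):FY\to FX$, $i$ the inclusion. Correspondingly, a functor $H$ on $\mathbf{Set}\times\mathbf{Set}$ is bounded if there is a cardinal $\kappa$ such that for every object $(A,B)$ and every element of either component of $H(A,B)$ there are subsets $A'\subseteq A$, $B'\subseteq B$ of cardinality $<\kappa$ such that this element lies in the corresponding component of the image of $H(i_{A'},i_{B'})$, where $i_{A'},i_{B'}$ are the inclusions. -}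

module Defs where

open import Data.Product using (Σ; Σ-syntax; _×_; _,_; proj₁; proj₂)
open import Data.Unit using (⊤; tt)
open import Function using (_∘_; id)
open import Function.Definitions using (Injective)
open import Relation.Binary.PropositionalEquality using (_≡_; refl; sym; trans; cong)
open import Relation.Nullary using (¬_)

-- Small categories (objects and hom-sets are sets, i.e. types in Set₀;
-- equality of morphisms is propositional equality).

record Category : Set₁ where
  field
    Obj  : Set
    Hom  : Obj → Obj → Set
    idC  : ∀ {i} → Hom i i
    _∘C_ : ∀ {i j k} → Hom j k → Hom i j → Hom i k
    identityˡ : ∀ {i j} (f : Hom i j) → idC ∘C f ≡ f
    identityʳ : ∀ {i j} (f : Hom i j) → f ∘C idC ≡ f
    assoc : ∀ {i j k l} (f : Hom i j) (g : Hom j k) (h : Hom k l) →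
            (h ∘C g) ∘C f ≡ h ∘C (g ∘C f)

-- Endofunctors on Set (equality of functions = pointwise equality).

record Functor : Set₁ where
  field
    F₀ : Set → Set
    F₁ : ∀ {A B} → (A → B) → F₀ A → F₀ B
    F-resp : ∀ {A B} (f g : A → B) → (∀ a → f a ≡ g a) → ∀ x → F₁ f x ≡ F₁ g x
    F-id : ∀ {A} (x : F₀ A) → F₁ (id {A = A}) x ≡ x
    F-∘ : ∀ {A B C} (f : A → B) (g : B → C) (x : F₀ A) →
          F₁ (g ∘ f) x ≡ F₁ g (F₁ f x)
open Functor public

module _ (I : Category) where
  open Category I

  record Diagram : Set₁ where
    field
      D₀ : Obj → Set
      D₁ : ∀ {i j} → Hom i j → D₀ i → D₀ j
      D-id : ∀ {i} (x : D₀ i) → D₁ (idC {i}) x ≡ x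
      D-∘ : ∀ {i j k} (f : Hom i j) (g : Hom j k) (x : D₀ i) →
            D₁ (g ∘C f) x ≡ D₁ g (D₁ f x)
  open Diagram public

  record Cone (D : Diagram) (L : Set) : Set where
    field
      leg : ∀ i → L → D₀ D i
      commute : ∀ {i j} (f : Hom i j) (x : L) → D₁ D f (leg i x) ≡ leg j x
  open Cone public

  IsLimit : (D : Diagram) {L : Set} → Cone D L → Set₁
  IsLimit D {L} c =
    ∀ (M : Set) (d : Cone D M) →
      Σ[ u ∈ (M → L) ]
        ((∀ i m → leg c i (u m) ≡ leg d i m) ×
         (∀ (u' : M → L) → (∀ i m → leg c i (u' m) ≡ leg d i m) →
            ∀ m → u' m ≡ u m))

  _∘D_ : Functor → Diagram → Diagram
  F ∘D D = record
    { D₀ = λ i → F₀ F (D₀ D i)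
    ; D₁ = λ f → F₁ F (D₁ D f)
    ; D-id = λ x → trans (F-resp F _ id (D-id D) x) (F-id F x)
    ; D-∘ = λ f g x → trans (F-resp F _ _ (D-∘ D f g) x) (F-∘ F (D₁ D f) (D₁ D g) x)
    }

  mapCone : (F : Functor) {D : Diagram} {L : Set} → Cone D L → Cone (F ∘D D) (F₀ F L)
  mapCone F {D} c = record
    { leg = λ i → F₁ F (leg c i)
    ; commute = λ f x → trans (sym (F-∘ F (leg c _) (D₁ D f) x))
                              (F-resp F _ _ (commute c f) x)
    }

PreservesLimitsOfShape : Category → Functor → Set₁
PreservesLimitsOfShape I F =
  ∀ (D : Diagram I) (L : Set) (c : Cone I D L) →
    IsLimit I D c → IsLimit I (_∘D_ I F D) (mapCone I F c)

Obj² : Set₁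
Obj² = Set × Set

Mor² : Obj² → Obj² → Set
Mor² (A , B) (A' , B') = (A → A') × (B → B')

id² : ∀ {X} → Mor² X X
id² = id , id

_∘²_ : ∀ {X Y Z} → Mor² Y Z → Mor² X Y → Mor² X Z
(g₁ , g₂) ∘² (f₁ , f₂) = (g₁ ∘ f₁) , (g₂ ∘ f₂)

_≈²_ : ∀ {X Y} → Mor² X Y → Mor² X Y → Set
(f₁ , f₂) ≈² (g₁ , g₂) = (∀ a → f₁ a ≡ g₁ a) × (∀ b → f₂ b ≡ g₂ b)

record Functor² : Set₁ where
  field
    H₀ : Obj² → Obj²
    H₁ : ∀ {X Y} → Mor² X Y → Mor² (H₀ X) (H₀ Y)
    H-resp : ∀ {X Y} (f g : Mor² X Y) → f ≈² g → H₁ f ≈² H₁ g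
    H-id : ∀ {X} → H₁ (id² {X}) ≈² id²
    H-∘ : ∀ {X Y Z} (f : Mor² X Y) (g : Mor² Y Z) → H₁ (g ∘² f) ≈² (H₁ g ∘² H₁ f)
open Functor² public

module _ (I : Category) where
  open Category I

  record Diagram² : Set₁ where
    field
      E₀ : Obj → Obj²
      E₁ : ∀ {i j} → Hom i j → Mor² (E₀ i) (E₀ j)
      E-id : ∀ {i} → E₁ (idC {i}) ≈² id²
      E-∘ : ∀ {i j k} (f : Hom i j) (g : Hom j k) → E₁ (g ∘C f) ≈² (E₁ g ∘² E₁ f)
  open Diagram² public

  record Cone² (D : Diagram²) (L : Obj²) : Set where
    field
      leg² : ∀ i → Mor² L (E₀ D i)
      commute² : ∀ {i j} (f : Hom i j) → (E₁ D f ∘² leg² i) ≈² leg² j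
  open Cone² public

  IsLimit² : (D : Diagram²) {L : Obj²} → Cone² D L → Set₁
  IsLimit² D {L} c =
    ∀ (M : Obj²) (d : Cone² D M) →
      Σ[ u ∈ Mor² M L ]
        ((∀ i → (leg² c i ∘² u) ≈² leg² d i) ×
         (∀ (u' : Mor² M L) → (∀ i → (leg² c i ∘² u') ≈² leg² d i) → u' ≈² u))

  private
    ≈²-trans : ∀ {X Y} {f g h : Mor² X Y} → f ≈² g → g ≈² h → f ≈² h
    ≈²-trans (p₁ , p₂) (q₁ , q₂) = (λ a → trans (p₁ a) (q₁ a)) , (λ b → trans (p₂ b) (q₂ b))

    ≈²-sym : ∀ {X Y} {f g : Mor² X Y} → f ≈² g → g ≈² f
    ≈²-sym (p₁ , p₂) = (λ a → sym (p₁ a)) , (λ b → sym (p₂ b))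

  _∘D²_ : Functor² → Diagram² → Diagram²
  H ∘D² D = record
    { E₀ = λ i → H₀ H (E₀ D i)
    ; E₁ = λ f → H₁ H (E₁ D f)
    ; E-id = ≈²-trans (H-resp H _ _ (E-id D)) (H-id H)
    ; E-∘ = λ f g → ≈²-trans (H-resp H _ _ (E-∘ D f g)) (H-∘ H (E₁ D f) (E₁ D g))
    }

  mapCone² : (H : Functor²) {D : Diagram²} {L : Obj²} → Cone² D L → Cone² (H ∘D² D) (H₀ H L)
  mapCone² H {D} c = record
    { leg² = λ i → H₁ H (leg² c i)
    ; commute² = λ f → ≈²-trans (≈²-sym (H-∘ H (leg² c _) (E₁ D f)))
                                (H-resp H _ _ (commute² c f))
    }

PreservesLimitsOfShape² : Category → Functor² → Set₁
PreservesLimitsOfShape² I H =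
  ∀ (D : Diagram² I) (L : Obj²) (c : Cone² I D L) →
    IsLimit² I D c → IsLimit² I (_∘D²_ I H D) (mapCone² I H c)

Fbar : Functor → Functor²
Fbar F = record
  { H₀ = λ X → ⊤ , F₀ F (proj₁ X)
  ; H₁ = λ f → (λ _ → tt) , F₁ F (proj₁ f)
  ; H-resp = λ f g p → (λ _ → refl) , F-resp F (proj₁ f) (proj₁ g) (proj₁ p)
  ; H-id = (λ _ → refl) , F-id F
  ; H-∘ = λ f g → (λ _ → refl) , F-∘ F (proj₁ f) (proj₁ g)
  }

-- A ↪ B : there is an injection A → B, i.e. |A| ≤ |B|.
_↪_ : Set → Set → Set
A ↪ B = Σ[ f ∈ (A → B) ] Injective _≡_ _≡_ f

-- |A| < |K| (strict cardinal inequality, with the cardinal κ = |K|).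
_<ᶜ_ : Set → Set → Set
A <ᶜ K = (A ↪ K) × ¬ (K ↪ A)

record Subset (X : Set) : Set₁ where
  field
    mem : X → Set
    mem-prop : ∀ x (p q : mem x) → p ≡ q
open Subset public

⟦_⟧ : ∀ {X} → Subset X → Set
⟦_⟧ {X} Y = Σ X (mem Y)

incl : ∀ {X} (Y : Subset X) → ⟦ Y ⟧ → X
incl Y = proj₁

-- Boundedness.  A cardinal κ is represented by a set K with κ = |K|.

Bounded : Functor → Set₁
Bounded F =
  Σ[ K ∈ Set ] ∀ (X : Set) (x : F₀ F X) →
    Σ[ Y ∈ Subset X ] ((⟦ Y ⟧ <ᶜ K) ×
      Σ[ y ∈ F₀ F ⟦ Y ⟧ ] F₁ F (incl Y) y ≡ x)

Bounded² : Functor² → Set₁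
Bounded² H =
  Σ[ K ∈ Set ] ∀ (A B : Set) →
    (∀ (x : proj₁ (H₀ H (A , B))) →
       Σ[ A' ∈ Subset A ] Σ[ B' ∈ Subset B ] ((⟦ A' ⟧ <ᶜ K) × (⟦ B' ⟧ <ᶜ K) ×
         Σ[ y ∈ proj₁ (H₀ H (⟦ A' ⟧ , ⟦ B' ⟧)) ] proj₁ (H₁ H (incl A' , incl B')) y ≡ x))
    ×
    (∀ (x : proj₂ (H₀ H (A , B))) →
       Σ[ A' ∈ Subset A ] Σ[ B' ∈ Subset B ] ((⟦ A' ⟧ <ᶜ K) × (⟦ B' ⟧ <ᶜ K) ×
         Σ[ y ∈ proj₂ (H₀ H (⟦ A' ⟧ , ⟦ B' ⟧)) ] proj₂ (H₁ H (incl A' , incl B')) y ≡ x))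

-- Limits in Set × Set are computed componentwise; conversely a limit in Set × Set is a limit
-- in its first factor, as one sees by testing it against cones whose second apex is empty.
-- F̄ sends a limit cone (L₁ , L₂) to (1 , F L₁): the first component is a limit of a diagram
-- of singletons, the second is F applied to the first-factor limit.  For boundedness, an
-- element of F V lies in F of a small subset of V, and the edge component needs no vertices;
-- replacing κ by κ + 1 makes the empty subset small even when κ = 0.
module Submission where

open import Defs
open import Data.Empty using (⊥)
open import Data.Product using (_×_; _,_; proj₁; proj₂)
open import Data.Sum using (_⊎_; inj₁; inj₂)
open import Data.Sum.Properties using (inj₁-injective)
open import Data.Unit using (⊤; tt)
open import Relation.Binary.PropositionalEquality using (_≡_; refl)

module _ {I : Category} where

  proj₁ᴰ proj₂ᴰ : Diagram² I → Diagram I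
  proj₁ᴰ D = record
    { D₀ = λ i → proj₁ (E₀ D i)
    ; D₁ = λ f → proj₁ (E₁ D f)
    ; D-id = proj₁ (E-id D)
    ; D-∘ = λ f g → proj₁ (E-∘ D f g)
    }
  proj₂ᴰ D = record
    { D₀ = λ i → proj₂ (E₀ D i)
    ; D₁ = λ f → proj₂ (E₁ D f)
    ; D-id = proj₂ (E-id D)
    ; D-∘ = λ f g → proj₂ (E-∘ D f g)
    }

  proj₁ᶜ : {D : Diagram² I} {L : Obj²} → Cone² I D L → Cone I (proj₁ᴰ D) (proj₁ L)
  proj₁ᶜ c = record
    { leg = λ i → proj₁ (leg² c i)
    ; commute = λ f → proj₁ (commute² c f)
    }

  proj₂ᶜ : {D : Diagram² I} {L : Obj²} → Cone² I D L → Cone I (proj₂ᴰ D) (proj₂ L)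
  proj₂ᶜ c = record
    { leg = λ i → proj₂ (leg² c i)
    ; commute = λ f → proj₂ (commute² c f)
    }

  pairᶜ : {D : Diagram² I} {M₁ M₂ : Set} →
          Cone I (proj₁ᴰ D) M₁ → Cone I (proj₂ᴰ D) M₂ → Cone² I D (M₁ , M₂)
  pairᶜ d₁ d₂ = record
    { leg² = λ i → leg d₁ i , leg d₂ i
    ; commute² = λ f → commute d₁ f , commute d₂ f
    }

  proj₁-isLimit : {D : Diagram² I} {L : Obj²} (c : Cone² I D L) →
                  IsLimit² I D c → IsLimit I (proj₁ᴰ D) (proj₁ᶜ c)
  proj₁-isLimit {D} c isLim M d with isLim (M , ⊥) (pairᶜ d ∅ᶜ)
    where
      ∅ᶜ : Cone I (proj₂ᴰ D) ⊥
      ∅ᶜ = record { leg = λ i (); commute = λ f () }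
  ... | (u₁ , u₂) , factors , unique =
    u₁ , (λ i → proj₁ (factors i)) ,
    λ u' factors' → proj₁ (unique (u' , u₂) (λ i → factors' i , λ ()))

  isLimit²-componentwise : {D : Diagram² I} {L : Obj²} (c : Cone² I D L) →
                           IsLimit I (proj₁ᴰ D) (proj₁ᶜ c) → IsLimit I (proj₂ᴰ D) (proj₂ᶜ c) →
                           IsLimit² I D c
  isLimit²-componentwise c isLim₁ isLim₂ (M₁ , M₂) d
    with isLim₁ M₁ (proj₁ᶜ d) | isLim₂ M₂ (proj₂ᶜ d)
  ... | u₁ , factors₁ , unique₁ | u₂ , factors₂ , unique₂ =
    (u₁ , u₂) , (λ i → factors₁ i , factors₂ i) ,
    λ (u₁' , u₂') factors' → unique₁ u₁' (λ i → proj₁ (factors' i)) ,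
                             unique₂ u₂' (λ i → proj₂ (factors' i))

  isLimit-subsingleton : (D : Diagram I) (c : Cone I D ⊤) →
                         (∀ i (x y : D₀ D i) → x ≡ y) → IsLimit I D c
  isLimit-subsingleton D c subsingleton M d =
    (λ _ → tt) , (λ i m → subsingleton i _ _) , λ u' factors' m → refl

FbarPreservesLimitsOfShape : (I : Category) (F : Functor) →
                             PreservesLimitsOfShape I F → PreservesLimitsOfShape² I (Fbar F)
FbarPreservesLimitsOfShape I F preserves D L c isLim =
  isLimit²-componentwise F̄c
    (isLimit-subsingleton (proj₁ᴰ (_∘D²_ I (Fbar F) D)) (proj₁ᶜ F̄c) (λ i x y → refl))
    (preserves (proj₁ᴰ D) (proj₁ L) (proj₁ᶜ c) (proj₁-isLimit c isLim))
  where
    F̄c : Cone² I (_∘D²_ I (Fbar F) D) (H₀ (Fbar F) L)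
    F̄c = mapCone² I (Fbar F) c

∅ : {X : Set} → Subset X
∅ = record { mem = λ _ → ⊥ ; mem-prop = λ _ () }

∅<ᶜ : {X K : Set} → K → ⟦ ∅ {X} ⟧ <ᶜ K
∅<ᶜ k = ((λ ()) , λ { {()} }) , λ (g , _) → proj₂ (g k)

<ᶜ-⊎ : {A K B : Set} → A <ᶜ K → A <ᶜ (K ⊎ B)
<ᶜ-⊎ ((f , f-injective) , ¬K↪A) =
  ((λ a → inj₁ (f a)) , λ eq → f-injective (inj₁-injective eq)) ,
  λ (g , g-injective) → ¬K↪A ((λ k → g (inj₁ k)) , λ eq → inj₁-injective (g-injective eq))

bounded-from-Fbar : (F : Functor) → Bounded² (Fbar F) → Bounded F
bounded-from-Fbar F (K , bound) = K , λ V x →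
  let (V' , _ , V'<K , _ , y , y↦x) = proj₂ (bound V ⊤) x in V' , V'<K , y , y↦x

Fbar-bounded : (F : Functor) → Bounded F → Bounded² (Fbar F)
Fbar-bounded F (K , bound) = (K ⊎ ⊤) , λ V E →
  (λ _ → ∅ , ∅ , ∅<ᶜ (inj₂ tt) , ∅<ᶜ (inj₂ tt) , tt , refl) ,
  (λ x → let (V' , V'<K , y , y↦x) = bound V x in V' , ∅ , <ᶜ-⊎ V'<K , ∅<ᶜ (inj₂ tt) , y , y↦x)

mainTheorem1 : (F : Functor) →
    (∀ (I : Category) → PreservesLimitsOfShape I F → PreservesLimitsOfShape² I (Fbar F))
    × (Bounded² (Fbar F) → Bounded F)
    × (Bounded F → Bounded² (Fbar F))
mainTheorem1 F = (λ I → FbarPreservesLimitsOfShape I F) , bounded-from-Fbar F , Fbar-bounded F
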